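{- Let $g:\{0,1\}^n\to\{0,1\}^{n+1}$ be a super-bit and define $f(x)\in\{0,1\}^n$ and $b(x)\in\{0,1\}$ by $f(x)b(x):=g(x)$, where $b(x)$ is the last bit of $g(x)$. Then $b$ is a super-core of $f\in\mathsf{P}/\mathsf{poly}$.
   Context: A $\mathsf{P}/\mathsf{poly}$-computable $g:\{0,1\}^n\to\{0,1\}^{n+1}$ is a super-bit if for every $D\in\mathsf{NP}/\mathsf{poly}$, every polynomial $p$, and all sufficiently large $n$, $\Pr[D(U_{n+1})=1]-\Pr[D(g(U_n))=1]<1/p(n)$, where $U_k$ is uniform on $\{0,1\}^k$. A predicate $b:\{0,1\}^n\to\{0,1\}$ in $\mathsf{P}/\mathsf{poly}$ is a super-core of $f:\{0,1\}^n\to\{0,1\}^{m(n)}$ if (a) there do not exist $\mathcal{A}_1\in\mathsf{NP}/\mathsf{poly}$, a polynomial $p$, and infinitely many $n$ with $\Pr_{x\in\{0,1\}^n}[\mathcal{A}_1(f(x),1^n)=b(x)=0]+\frac12\Pr_{y\in\{0,1\}^{m}}[\mathcal{A}_1(y,1^n)=1]\ge \frac12+\frac1{p(n)}$, and (b) there do not exist $\mathcal{A}_2\in\mathsf{coNP}/\mathsf{poly}$, a polynomial $p$, and infinitely many $n$ with $\Pr_{x}[\mathcal{A}_2(f(x),1^n)=b(x)=1]+\frac12\Pr_{y}[\mathcal{A}_2(y,1^n)=0]\ge \frac12+\frac1{p(n)}$. -}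

module Defs where

open import Data.Bool using (Bool; true; false; not; _∧_; _∨_)
open import Data.Nat using (ℕ; zero; suc; _+_; _*_; _^_; _≤_; _<_)
open import Data.Fin using (Fin)
open import Data.Vec using (Vec; []; _∷_; lookup; map; _++_; replicate; init; last)
open import Data.List using (List; []; _∷_; length; filter; concatMap)
import Data.List as L
open import Data.Product using (Σ; ∃; _×_; _,_)
open import Data.Empty using (⊥)
open import Relation.Nullary using (¬_)
open import Relation.Binary.PropositionalEquality using (_≡_)
open import Function.Bundles using (_⇔_)

Poly : Set
Poly = List ℕ

⟦_⟧ : Poly → ℕ → ℕ
⟦ [] ⟧ n = 0
⟦ c ∷ cs ⟧ n = c + n * ⟦ cs ⟧ n

-- Boolean circuits as straight-line programs.
-- A circuit with k inputs and s gates has s + k wires; each new gate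
-- is prepended (wire index zero) and may read any earlier wire.

data Gate (w : ℕ) : Set where
  const : Bool → Gate w
  neg   : Fin w → Gate w
  and   : Fin w → Fin w → Gate w
  or    : Fin w → Fin w → Gate w

data Circuit (k : ℕ) : ℕ → Set where
  nil : Circuit k 0
  _▷_ : ∀ {s} → Circuit k s → Gate (s + k) → Circuit k (suc s)

evalGate : ∀ {w} → Gate w → Vec Bool w → Bool
evalGate (const b) v = b
evalGate (neg i)   v = not (lookup v i)
evalGate (and i j) v = lookup v i ∧ lookup v j
evalGate (or i j)  v = lookup v i ∨ lookup v j

eval : ∀ {k s} → Circuit k s → Vec Bool k → Vec Bool (s + k)
eval nil x = x
eval (C ▷ g) x = let v = eval C x in evalGate g v ∷ v

InPpoly : {m : ℕ → ℕ} → ((n : ℕ) → Vec Bool n → Vec Bool (m n)) → Set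
InPpoly {m} F =
  Σ Poly λ p → (n : ℕ) →
    Σ ℕ λ s → Σ (Circuit n s) λ C → Σ (Vec (Fin (s + n)) (m n)) λ out →
      (s ≤ ⟦ p ⟧ n) × ((x : Vec Bool n) → map (lookup (eval C x)) out ≡ F n x)

InPpolyPred : ((n : ℕ) → Vec Bool n → Bool) → Set
InPpolyPred b = InPpoly {λ _ → 1} (λ n x → b n x ∷ [])

InNPpoly : ((k : ℕ) → Vec Bool k → Bool) → Set
InNPpoly L =
  Σ Poly λ p → (k : ℕ) →
    Σ ℕ λ s → Σ (Circuit (k + ⟦ p ⟧ k) s) λ C → Σ (Fin (s + (k + ⟦ p ⟧ k))) λ o →
      (s ≤ ⟦ p ⟧ k) ×
      ((x : Vec Bool k) →
        (L k x ≡ true) ⇔ (Σ (Vec Bool (⟦ p ⟧ k)) λ w → lookup (eval C (x ++ w)) o ≡ true))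

InCoNPpoly : ((k : ℕ) → Vec Bool k → Bool) → Set
InCoNPpoly L = InNPpoly (λ k x → not (L k x))

-- Counting (uniform probability = count / 2^k)

allVecs : (k : ℕ) → List (Vec Bool k)
allVecs zero = [] ∷ []
allVecs (suc k) = concatMap (λ v → (false ∷ v) ∷ (true ∷ v) ∷ []) (allVecs k)

count : (k : ℕ) → (Vec Bool k → Bool) → ℕ
count k P = length (filter (λ x → P x Data.Bool.≟ true) (allVecs k))

Eventually : (ℕ → Set) → Set
Eventually P = Σ ℕ λ N → (n : ℕ) → N ≤ n → P n

InfinitelyOften : (ℕ → Set) → Set
InfinitelyOften P = (N : ℕ) → Σ ℕ λ n → (N ≤ n) × P n

ones : (n : ℕ) → Vec Bool n
ones n = replicate n true

-- Super-bit.
-- Pr[D(U_{n+1})=1] - Pr[D(g(U_n))=1] < 1/p(n), i.e.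
--   c₁/2^{n+1} - c₂/2^n < 1/p(n)  ⇔  c₁·p(n) < 2^{n+1} + 2·c₂·p(n)
-- (for p(n) = 0 we read 1/p(n) as +∞).

SuperBit : ((n : ℕ) → Vec Bool n → Vec Bool (suc n)) → Set
SuperBit g =
  InPpoly g ×
  ((D : (k : ℕ) → Vec Bool k → Bool) → InNPpoly D → (p : Poly) →
    Eventually λ n →
      count (suc n) (D (suc n)) * ⟦ p ⟧ n
        < 2 ^ suc n + 2 * count n (λ x → D (suc n) (g n x)) * ⟦ p ⟧ n)

-- Pr_x[A(f x,1^n)=b x=β] + ½ Pr_y[A(y,1^n)=1-β] ≥ ½ + 1/p(n), i.e. with
--   c₁ = #{x | A = b x = β}, c₂ = #{y | A = 1-β}:
--   c₁/2^n + c₂/2^{m+1} ≥ ½ + 1/p(n)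
--   ⇔ p(n)·(2^{m+1}·c₁ + 2^n·c₂) ≥ p(n)·2^{n+m} + 2^{n+m+1}

_==_ : Bool → Bool → Bool
false == false = true
true  == true  = true
_     == _     = false

Advantage : {m : ℕ → ℕ} → ((n : ℕ) → Vec Bool n → Vec Bool (m n)) →
            ((n : ℕ) → Vec Bool n → Bool) →
            ((k : ℕ) → Vec Bool k → Bool) → Bool → Poly → ℕ → Set
Advantage {m} f b A β p n =
  ⟦ p ⟧ n * 2 ^ (n + m n) + 2 ^ suc (n + m n)
    ≤ ⟦ p ⟧ n * (2 ^ suc (m n) * c₁ + 2 ^ n * c₂)
  where
  c₁ = count n (λ x → (A (m n + n) (f n x ++ ones n) == β) ∧ (b n x == β))
  c₂ = count (m n) (λ y → not (A (m n + n) (y ++ ones n) == β))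

SuperCore : {m : ℕ → ℕ} → ((n : ℕ) → Vec Bool n → Vec Bool (m n)) →
            ((n : ℕ) → Vec Bool n → Bool) → Set
SuperCore f b =
  InPpolyPred b ×
  ¬ (Σ ((k : ℕ) → Vec Bool k → Bool) λ A₁ → InNPpoly A₁ × Σ Poly λ p →
       InfinitelyOften (Advantage f b A₁ false p)) ×
  ¬ (Σ ((k : ℕ) → Vec Bool k → Bool) λ A₂ → InCoNPpoly A₂ × Σ Poly λ p →
       InfinitelyOften (Advantage f b A₂ true p))

firstBits : ((n : ℕ) → Vec Bool n → Vec Bool (suc n)) → (n : ℕ) → Vec Bool n → Vec Bool n
firstBits g n x = init (g n x)

lastBit : ((n : ℕ) → Vec Bool n → Vec Bool (suc n)) → (n : ℕ) → Vec Bool n → Bool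
lastBit g n x = last (g n x)

{-# OPTIONS --safe #-}
-- A super-core adversary A for the bit β gives the distinguisher D(y c) = [A(y,1ⁿ) ≠ β] ∨ [c ≠ β]
-- against g, which lies in NP/poly because [A ≠ β] is A itself for β = 0 and the complement
-- of the coNP/poly predicate A for β = 1. With a = #{y | A(y,1ⁿ) ≠ β} and
-- c = #{x | A(f x,1ⁿ) = b x = β}, D accepts a + 2ⁿ of the 2ⁿ⁺¹ strings of length n + 1 but only
-- 2ⁿ − c of the values g(x), so Pr[D(Uₙ₊₁)] − Pr[D(g(Uₙ))] = c/2ⁿ + a/2ⁿ⁺¹ − ½ is exactly the
-- advantage of A; the super-bit property makes it smaller than 1/p(n) for all large n.
module Submission where

open import Defs
open import Data.Bool using (Bool; true; false; not; _∧_; _∨_)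
import Data.Bool as Bool
open import Data.Bool.Properties using (∨-identityʳ; ∨-zeroʳ)
open import Data.Nat using (ℕ; zero; suc; _+_; _*_; _^_; _≤_; _<_; z≤n; s≤s; NonZero)
open import Data.Nat.Properties
open import Data.Nat.Tactic.RingSolver using (solve-∀)
open import Data.Fin using (Fin; zero; suc; inject₁; inject≤; fromℕ; _↑ˡ_; _↑ʳ_)
open import Data.Vec using (Vec; []; _∷_; lookup; map; _++_; replicate; init; last; tabulate)
open import Data.Vec.Properties
  using (map-++; tabulate-∘; tabulate-cong; tabulate∘lookup; lookup-map; map-replicate; lookup-++ˡ; lookup-++ʳ)
open import Data.List using (List; []; _∷_; length; filter; concatMap)
import Data.List as List
open import Data.Product using (Σ; _×_; _,_)
open import Data.Sum using (_⊎_; inj₁; inj₂; map₁)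
open import Function.Bundles using (_⇔_; mk⇔; Equivalence)
open import Relation.Nullary using (¬_)
open import Relation.Binary.PropositionalEquality

private
  variable
    k k′ n s t w w′ : ℕ

mapGate : (Fin w → Fin w′) → Gate w → Gate w′
mapGate f (const b) = const b
mapGate f (neg i)   = neg (f i)
mapGate f (and i j) = and (f i) (f j)
mapGate f (or i j)  = or (f i) (f j)

evalGate-mapGate : (f : Fin w → Fin w′) (G : Gate w) (V : Vec Bool w′) (U : Vec Bool w) →
                   (∀ i → lookup V (f i) ≡ lookup U i) → evalGate (mapGate f G) V ≡ evalGate G U
evalGate-mapGate f (const b) V U eq = refl
evalGate-mapGate f (neg i)   V U eq = cong not (eq i)
evalGate-mapGate f (and i j) V U eq = cong₂ _∧_ (eq i) (eq j)
evalGate-mapGate f (or i j)  V U eq = cong₂ _∨_ (eq i) (eq j)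

liftWire : ∀ s → (Fin k → Fin (t + k′)) → Fin (s + k) → Fin ((s + t) + k′)
liftWire zero    ρ i       = ρ i
liftWire (suc s) ρ zero    = zero
liftWire (suc s) ρ (suc i) = suc (liftWire s ρ i)

baseWire : ∀ s → Fin (t + k′) → Fin ((s + t) + k′)
baseWire zero    j = j
baseWire (suc s) j = suc (baseWire s j)

stack : Circuit k′ t → (Fin k → Fin (t + k′)) → Circuit k s → Circuit k′ (s + t)
stack P ρ nil           = P
stack P ρ (_▷_ {s} C G) = stack P ρ C ▷ mapGate (liftWire s ρ) G

module _ (P : Circuit k′ t) (ρ : Fin k → Fin (t + k′)) (x : Vec Bool k′) where

  eval-stack-liftWire : (u : Vec Bool k) → (∀ j → lookup (eval P x) (ρ j) ≡ lookup u j) →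
                        (C : Circuit k s) (i : Fin (s + k)) →
                        lookup (eval (stack P ρ C) x) (liftWire s ρ i) ≡ lookup (eval C u) i
  eval-stack-liftWire u eq nil i = eq i
  eval-stack-liftWire u eq (_▷_ {s} C G) zero =
    evalGate-mapGate (liftWire s ρ) G _ _ (eval-stack-liftWire u eq C)
  eval-stack-liftWire u eq (C ▷ G) (suc i) = eval-stack-liftWire u eq C i

  eval-stack-baseWire : (C : Circuit k s) (j : Fin (t + k′)) →
                        lookup (eval (stack P ρ C) x) (baseWire s j) ≡ lookup (eval P x) j
  eval-stack-baseWire nil     j = refl
  eval-stack-baseWire (C ▷ G) j = eval-stack-baseWire C j

χ : Bool → ℕ
χ true  = 1
χ false = 0

countIn : {A : Set} → (A → Bool) → List A → ℕ
countIn P []       = 0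
countIn P (x ∷ xs) = χ (P x) + countIn P xs

module _ {A : Set} where

  length-filter≡countIn : (P : A → Bool) (xs : List A) →
                          length (filter (λ x → P x Bool.≟ true) xs) ≡ countIn P xs
  length-filter≡countIn P []       = refl
  length-filter≡countIn P (x ∷ xs) with P x
  ... | true  = cong suc (length-filter≡countIn P xs)
  ... | false = length-filter≡countIn P xs

  countIn-cong : {P Q : A → Bool} → (∀ x → P x ≡ Q x) → (xs : List A) → countIn P xs ≡ countIn Q xs
  countIn-cong eq []       = refl
  countIn-cong eq (x ∷ xs) = cong₂ _+_ (cong χ (eq x)) (countIn-cong eq xs)

  countIn-true : (xs : List A) → countIn (λ _ → true) xs ≡ length xs
  countIn-true []       = refl
  countIn-true (x ∷ xs) = cong suc (countIn-true xs)

  countIn-complement : (P : A → Bool) (xs : List A) →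
                       countIn P xs + countIn (λ x → not (P x)) xs ≡ length xs
  countIn-complement P []       = refl
  countIn-complement P (x ∷ xs) with P x
  ... | true  = cong suc (countIn-complement P xs)
  ... | false = trans (+-suc _ _) (cong suc (countIn-complement P xs))

countIn-extend : (P : Vec Bool (suc k) → Bool) (vs : List (Vec Bool k)) →
                 countIn P (concatMap (λ v → (false ∷ v) ∷ (true ∷ v) ∷ []) vs) ≡
                 countIn (λ v → P (false ∷ v)) vs + countIn (λ v → P (true ∷ v)) vs
countIn-extend P []       = refl
countIn-extend P (v ∷ vs) =
  trans (cong (λ c → χ (P (false ∷ v)) + (χ (P (true ∷ v)) + c)) (countIn-extend P vs))
        (interchange (χ (P (false ∷ v))) (χ (P (true ∷ v))) (countIn _ vs) (countIn _ vs))
  where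
  interchange : ∀ a b c d → a + (b + (c + d)) ≡ (a + c) + (b + d)
  interchange = solve-∀

count≡countIn : ∀ k (P : Vec Bool k → Bool) → count k P ≡ countIn P (allVecs k)
count≡countIn k P = length-filter≡countIn P (allVecs k)

count-cong : ∀ k {P Q : Vec Bool k → Bool} → (∀ x → P x ≡ Q x) → count k P ≡ count k Q
count-cong k {P} {Q} eq =
  trans (count≡countIn k P) (trans (countIn-cong eq (allVecs k)) (sym (count≡countIn k Q)))

count-∷ : ∀ k (P : Vec Bool (suc k) → Bool) →
          count (suc k) P ≡ count k (λ v → P (false ∷ v)) + count k (λ v → P (true ∷ v))
count-∷ k P = trans (count≡countIn (suc k) P) (trans (countIn-extend P (allVecs k))
  (sym (cong₂ _+_ (count≡countIn k _) (count≡countIn k _))))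

count-true : ∀ k → count k (λ _ → true) ≡ 2 ^ k
count-true zero    = refl
count-true (suc k) = begin
  count (suc k) (λ _ → true)                  ≡⟨ count-∷ k (λ _ → true) ⟩
  count k (λ _ → true) + count k (λ _ → true) ≡⟨ cong₂ _+_ (count-true k) (count-true k) ⟩
  2 ^ k + 2 ^ k                               ≡⟨ cong (2 ^ k +_) (sym (+-identityʳ (2 ^ k))) ⟩
  2 ^ suc k                                   ∎
  where open ≡-Reasoning

count-complement : ∀ k (P : Vec Bool k → Bool) → count k P + count k (λ x → not (P x)) ≡ 2 ^ k
count-complement k P = begin
  count k P + count k (λ x → not (P x))
    ≡⟨ cong₂ _+_ (count≡countIn k P) (count≡countIn k _) ⟩
  countIn P (allVecs k) + countIn (λ x → not (P x)) (allVecs k)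
    ≡⟨ countIn-complement P (allVecs k) ⟩
  length (allVecs k)
    ≡⟨ sym (countIn-true (allVecs k)) ⟩
  countIn (λ _ → true) (allVecs k)
    ≡⟨ sym (count≡countIn k _) ⟩
  count k (λ _ → true)
    ≡⟨ count-true k ⟩
  2 ^ k ∎
  where open ≡-Reasoning

count-init-last : ∀ n (F : Vec Bool n → Bool → Bool) →
                  count (suc n) (λ z → F (init z) (last z)) ≡ count n (λ y → F y false) + count n (λ y → F y true)
count-init-last zero F = trans (count-∷ zero (λ z → F (init z) (last z)))
  (cong₂ _+_ (count-cong zero {λ v → F (init (false ∷ v)) (last (false ∷ v))} {λ y → F y false} λ { [] → refl })
             (count-cong zero {λ v → F (init (true ∷ v)) (last (true ∷ v))} {λ y → F y true} λ { [] → refl }))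
count-init-last (suc n) F = begin
  count (suc (suc n)) (λ z → F (init z) (last z))
    ≡⟨ count-∷ (suc n) _ ⟩
  count (suc n) (λ z → F (false ∷ init z) (last z)) + count (suc n) (λ z → F (true ∷ init z) (last z))
    ≡⟨ cong₂ _+_ (count-init-last n (λ y → F (false ∷ y))) (count-init-last n (λ y → F (true ∷ y))) ⟩
  (count n (λ y → F (false ∷ y) false) + count n (λ y → F (false ∷ y) true)) +
  (count n (λ y → F (true ∷ y) false) + count n (λ y → F (true ∷ y) true))
    ≡⟨ +-interchange (count n (λ y → F (false ∷ y) false)) _ _ _ ⟩
  (count n (λ y → F (false ∷ y) false) + count n (λ y → F (true ∷ y) false)) +
  (count n (λ y → F (false ∷ y) true) + count n (λ y → F (true ∷ y) true))
    ≡⟨ sym (cong₂ _+_ (count-∷ n (λ y → F y false)) (count-∷ n (λ y → F y true))) ⟩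
  count (suc n) (λ y → F y false) + count (suc n) (λ y → F y true) ∎
  where
  open ≡-Reasoning
  +-interchange : ∀ a b c d → (a + b) + (c + d) ≡ (a + c) + (b + d)
  +-interchange = solve-∀

scale : ℕ → Poly → Poly
scale c = List.map (c *_)

⟦scale⟧ : ∀ c p m → ⟦ scale c p ⟧ m ≡ c * ⟦ p ⟧ m
⟦scale⟧ c []       m = sym (*-zeroʳ c)
⟦scale⟧ c (a ∷ as) m = begin
  c * a + m * ⟦ scale c as ⟧ m ≡⟨ cong (λ v → c * a + m * v) (⟦scale⟧ c as m) ⟩
  c * a + m * (c * ⟦ as ⟧ m)   ≡⟨ cong (c * a +_) (*-comm-middle m c (⟦ as ⟧ m)) ⟩
  c * a + c * (m * ⟦ as ⟧ m)   ≡⟨ sym (*-distribˡ-+ c a _) ⟩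
  c * (a + m * ⟦ as ⟧ m)       ∎
  where
  open ≡-Reasoning
  *-comm-middle : ∀ x y z → x * (y * z) ≡ y * (x * z)
  *-comm-middle = solve-∀

dilate : ℕ → Poly → Poly
dilate c []       = []
dilate c (a ∷ as) = a ∷ scale c (dilate c as)

⟦dilate⟧ : ∀ c p m → ⟦ dilate c p ⟧ m ≡ ⟦ p ⟧ (c * m)
⟦dilate⟧ c []       m = refl
⟦dilate⟧ c (a ∷ as) m = cong (a +_) (begin
  m * ⟦ scale c (dilate c as) ⟧ m ≡⟨ cong (m *_) (⟦scale⟧ c (dilate c as) m) ⟩
  m * (c * ⟦ dilate c as ⟧ m)     ≡⟨ sym (*-assoc m c _) ⟩
  m * c * ⟦ dilate c as ⟧ m       ≡⟨ cong₂ _*_ (*-comm m c) (⟦dilate⟧ c as m) ⟩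
  c * m * ⟦ as ⟧ (c * m)          ∎)
  where open ≡-Reasoning

⟦⟧-mono : ∀ p {m m′} → m ≤ m′ → ⟦ p ⟧ m ≤ ⟦ p ⟧ m′
⟦⟧-mono []       m≤m′ = z≤n
⟦⟧-mono (a ∷ as) m≤m′ = +-monoʳ-≤ a (*-mono-≤ m≤m′ (⟦⟧-mono as m≤m′))

-- The 3 pays for the two prelude gates and the final or gate of the distinguisher circuit.
distinguisherPoly : Poly → Poly
distinguisherPoly p = 3 ∷ dilate 2 p

distinguisherPoly-bound : ∀ p n → 3 + ⟦ p ⟧ (n + n) ≤ ⟦ distinguisherPoly p ⟧ (suc n)
distinguisherPoly-bound p n = +-monoʳ-≤ 3 (begin
  ⟦ p ⟧ (n + n)                       ≤⟨ ⟦⟧-mono p (+-mono-≤ (n≤1+n n) (≤-trans (n≤1+n n) (m≤m+n (suc n) 0))) ⟩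
  ⟦ p ⟧ (2 * suc n)                   ≡⟨ sym (⟦dilate⟧ 2 p (suc n)) ⟩
  ⟦ dilate 2 p ⟧ (suc n)              ≤⟨ m≤n*m _ (suc n) ⟩
  suc n * ⟦ dilate 2 p ⟧ (suc n)      ∎)
  where open ≤-Reasoning

pad : ∀ {a b} → a ≤ b → Vec Bool a → Vec Bool b
pad {b = b} z≤n      []      = replicate b false
pad         (s≤s le) (x ∷ v) = x ∷ pad le v

restrict : ∀ {a b} → a ≤ b → Vec Bool b → Vec Bool a
restrict le v = tabulate (λ j → lookup v (inject≤ j le))

lookup-pad : ∀ {a b} (le : a ≤ b) (v : Vec Bool a) j → lookup (pad le v) (inject≤ j le) ≡ lookup v j
lookup-pad (s≤s le) (x ∷ v) zero    = refl
lookup-pad (s≤s le) (x ∷ v) (suc j) = lookup-pad le v j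

restrict-pad : ∀ {a b} (le : a ≤ b) (v : Vec Bool a) → restrict le (pad le v) ≡ v
restrict-pad le v = trans (tabulate-cong (lookup-pad le v)) (tabulate∘lookup v)

∨-≡-true : ∀ a b → (a ∨ b ≡ true) ⇔ (a ≡ true ⊎ b ≡ true)
∨-≡-true true  b = mk⇔ (λ _ → inj₁ refl) (λ _ → refl)
∨-≡-true false b = mk⇔ inj₂ λ { (inj₁ ()) ; (inj₂ b≡true) → b≡true }

lookup-inject₁ : (z : Vec Bool (suc n)) (i : Fin n) → lookup z (inject₁ i) ≡ lookup (init z) i
lookup-inject₁ (x ∷ y ∷ ys) zero    = refl
lookup-inject₁ (x ∷ y ∷ ys) (suc i) = lookup-inject₁ (y ∷ ys) i

lookup-fromℕ : (z : Vec Bool (suc n)) → lookup z (fromℕ n) ≡ last z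
lookup-fromℕ (x ∷ [])     = refl
lookup-fromℕ (x ∷ y ∷ ys) = lookup-fromℕ (y ∷ ys)

mismatchGate : Bool → Fin w → Gate w
mismatchGate false i = and i i
mismatchGate true  i = neg i

evalGate-mismatchGate : ∀ β (i : Fin w) v → evalGate (mismatchGate β i) v ≡ not (lookup v i == β)
evalGate-mismatchGate false i v with lookup v i
... | true  = refl
... | false = refl
evalGate-mismatchGate true  i v with lookup v i
... | true  = refl
... | false = refl

-- B is queried on y 1ⁿ, the input format (y, 1ⁿ) of a super-core adversary.
distinguisher : ((k : ℕ) → Vec Bool k → Bool) → Bool → (k : ℕ) → Vec Bool k → Bool
distinguisher B β zero    _ = false
distinguisher B β (suc n) z = B (n + n) (init z ++ ones n) ∨ not (last z == β)

module DistinguisherCircuit (β : Bool) (n : ℕ) (pᴮ : Poly) where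

  W Wᴮ : ℕ
  W  = ⟦ distinguisherPoly pᴮ ⟧ (suc n)
  Wᴮ = ⟦ pᴮ ⟧ (n + n)

  Wᴮ≤W : Wᴮ ≤ W
  Wᴮ≤W = ≤-trans (m≤n+m Wᴮ 3) (distinguisherPoly-bound pᴮ n)

  prelude : Circuit (suc n + W) 2
  prelude = (nil ▷ const true) ▷ mismatchGate β (suc (fromℕ n ↑ˡ W))

  mismatch : Vec Bool (suc n) → Bool
  mismatch z = not (last z == β)

  eval-prelude : ∀ z w → eval prelude (z ++ w) ≡ mismatch z ∷ true ∷ (z ++ w)
  eval-prelude z w = cong (_∷ true ∷ (z ++ w)) (begin
    evalGate (mismatchGate β _) (true ∷ (z ++ w)) ≡⟨ evalGate-mismatchGate β _ (true ∷ (z ++ w)) ⟩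
    not (lookup (z ++ w) (fromℕ n ↑ˡ W) == β)     ≡⟨ cong (λ c → not (c == β)) (lookup-++ˡ z w (fromℕ n)) ⟩
    not (lookup z (fromℕ n) == β)                 ≡⟨ cong (λ c → not (c == β)) (lookup-fromℕ z) ⟩
    mismatch z                                    ∎)
    where open ≡-Reasoning

  initWire : Fin n → Fin (2 + (suc n + W))
  initWire i = suc (suc (inject₁ i ↑ˡ W))

  witnessWire : Fin Wᴮ → Fin (2 + (suc n + W))
  witnessWire j = suc (suc (suc n ↑ʳ inject≤ j Wᴮ≤W))

  inputWires : Vec (Fin (2 + (suc n + W))) ((n + n) + Wᴮ)
  inputWires = (tabulate initWire ++ replicate n (suc zero)) ++ tabulate witnessWire

  module _ (z : Vec Bool (suc n)) (w : Vec Bool W) where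

    wire : Fin (2 + (suc n + W)) → Bool
    wire = lookup (mismatch z ∷ true ∷ (z ++ w))

    map-initWire : map wire (tabulate initWire) ≡ init z
    map-initWire = begin
      map wire (tabulate initWire)                       ≡⟨ tabulate-∘ wire initWire ⟨
      tabulate (λ i → lookup (z ++ w) (inject₁ i ↑ˡ W))  ≡⟨ tabulate-cong (λ i → lookup-++ˡ z w (inject₁ i)) ⟩
      tabulate (λ i → lookup z (inject₁ i))              ≡⟨ tabulate-cong (lookup-inject₁ z) ⟩
      tabulate (lookup (init z))                         ≡⟨ tabulate∘lookup (init z) ⟩
      init z                                             ∎
      where open ≡-Reasoning

    map-witnessWire : map wire (tabulate witnessWire) ≡ restrict Wᴮ≤W w
    map-witnessWire = trans (sym (tabulate-∘ wire witnessWire)) (tabulate-cong λ j → lookup-++ʳ z w (inject≤ j Wᴮ≤W))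

    map-inputWires : map (lookup (eval prelude (z ++ w))) inputWires ≡ (init z ++ ones n) ++ restrict Wᴮ≤W w
    map-inputWires = begin
      map (lookup (eval prelude (z ++ w))) inputWires
        ≡⟨ cong (λ v → map (lookup v) inputWires) (eval-prelude z w) ⟩
      map wire ((tabulate initWire ++ replicate n (suc zero)) ++ tabulate witnessWire)
        ≡⟨ map-++ wire _ (tabulate witnessWire) ⟩
      map wire (tabulate initWire ++ replicate n (suc zero)) ++ map wire (tabulate witnessWire)
        ≡⟨ cong₂ _++_ (map-++ wire (tabulate initWire) _) map-witnessWire ⟩
      (map wire (tabulate initWire) ++ map wire (replicate n (suc zero))) ++ restrict Wᴮ≤W w
        ≡⟨ cong (λ v → (v ++ map wire (replicate n (suc zero))) ++ restrict Wᴮ≤W w) map-initWire ⟩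
      (init z ++ map wire (replicate n (suc zero))) ++ restrict Wᴮ≤W w
        ≡⟨ cong (λ v → (init z ++ v) ++ restrict Wᴮ≤W w) (map-replicate wire (suc zero) n) ⟩
      (init z ++ ones n) ++ restrict Wᴮ≤W w
        ∎
      where open ≡-Reasoning

  module _ {s : ℕ} (C : Circuit ((n + n) + Wᴮ) s) (o : Fin (s + ((n + n) + Wᴮ))) where

    circuit : Circuit (suc n + W) (suc (s + 2))
    circuit = stack prelude (lookup inputWires) C ▷ or (liftWire s (lookup inputWires) o) (baseWire s zero)

    circuit-output : ∀ z w → lookup (eval circuit (z ++ w)) zero ≡
                     lookup (eval C ((init z ++ ones n) ++ restrict Wᴮ≤W w)) o ∨ mismatch z
    circuit-output z w = cong₂ _∨_
      (eval-stack-liftWire prelude (lookup inputWires) (z ++ w) _ inputs-ok C o)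
      (trans (eval-stack-baseWire prelude (lookup inputWires) (z ++ w) C zero)
             (cong (λ v → lookup v zero) (eval-prelude z w)))
      where
      inputs-ok : ∀ j → lookup (eval prelude (z ++ w)) (lookup inputWires j) ≡
                        lookup ((init z ++ ones n) ++ restrict Wᴮ≤W w) j
      inputs-ok j = trans (sym (lookup-map j _ inputWires)) (cong (λ v → lookup v j) (map-inputWires z w))

InNPpoly-distinguisher : ∀ {B} β → InNPpoly B → InNPpoly (distinguisher B β)
InNPpoly-distinguisher {B} β (pᴮ , circuitsᴮ) = distinguisherPoly pᴮ , circuits
  where
  circuits : (k : ℕ) → _
  circuits zero = 1 , nil ▷ const false , zero , s≤s z≤n , λ _ → mk⇔ (λ ()) λ { (_ , ()) }
  circuits (suc n) with circuitsᴮ (n + n)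
  ... | s , C , o , s≤pᴮ , correct = suc (s + 2) , circuit C o , zero , size , λ z → mk⇔ (accept z) (sound z)
    where
    open DistinguisherCircuit β n pᴮ

    size : suc (s + 2) ≤ W
    size = ≤-trans (≤-reflexive (cong suc (+-comm s 2)))
                   (≤-trans (+-monoʳ-≤ 3 s≤pᴮ) (distinguisherPoly-bound pᴮ n))

    accept : ∀ z → distinguisher B β (suc n) z ≡ true →
             Σ (Vec Bool W) λ w → lookup (eval (circuit C o) (z ++ w)) zero ≡ true
    accept z D≡true with Equivalence.to (∨-≡-true _ (mismatch z)) D≡true
    ... | inj₁ B≡true =
      let w , C≡true = Equivalence.to (correct (init z ++ ones n)) B≡true in
      pad Wᴮ≤W w , trans (circuit-output C o z (pad Wᴮ≤W w)) (Equivalence.from (∨-≡-true _ (mismatch z))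
        (inj₁ (trans (cong (λ v → lookup (eval C ((init z ++ ones n) ++ v)) o) (restrict-pad Wᴮ≤W w)) C≡true)))
    ... | inj₂ mismatch≡true =
      replicate W false , trans (circuit-output C o z _) (Equivalence.from (∨-≡-true _ (mismatch z)) (inj₂ mismatch≡true))

    sound : ∀ z → (Σ (Vec Bool W) λ w → lookup (eval (circuit C o) (z ++ w)) zero ≡ true) →
            distinguisher B β (suc n) z ≡ true
    sound z (w , accepted) = Equivalence.from (∨-≡-true _ (mismatch z))
      (map₁ (λ C≡true → Equivalence.from (correct (init z ++ ones n)) (restrict Wᴮ≤W w , C≡true))
        (Equivalence.to (∨-≡-true _ (mismatch z)) (trans (sym (circuit-output C o z w)) accepted)))

InNPpoly-cong : ∀ {L L′ : (k : ℕ) → Vec Bool k → Bool} → (∀ k x → L k x ≡ L′ k x) → InNPpoly L → InNPpoly L′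
InNPpoly-cong L≡L′ (p , circuits) = p , λ k →
  let s , C , o , s≤p , correct = circuits k in
  s , C , o , s≤p , λ x → subst (λ b → (b ≡ true) ⇔ _) (L≡L′ k x) (correct x)

advantage⇒gap : ∀ P N a c cᵍ .{{_ : NonZero N}} → c + cᵍ ≡ N →
                P * (N * N) + 2 * (N * N) ≤ P * (2 * N * c + N * a) →
                2 * N + 2 * cᵍ * P ≤ (a + N) * P
advantage⇒gap P N a c cᵍ c+cᵍ≡N adv =
  *-cancelˡ-≤ N (+-cancelˡ-≤ (P * (N * N)) _ _ (subst₂ _≤_ (lhs P N cᵍ) rhs′ (+-monoˡ-≤ (2 * N * cᵍ * P) adv)))
  where
  lhs : ∀ P N cᵍ → P * (N * N) + 2 * (N * N) + 2 * N * cᵍ * P ≡ P * (N * N) + N * (2 * N + 2 * cᵍ * P)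
  lhs = solve-∀
  rhs : ∀ P a c cᵍ → P * (2 * (c + cᵍ) * c + (c + cᵍ) * a) + 2 * (c + cᵍ) * cᵍ * P
                   ≡ P * ((c + cᵍ) * (c + cᵍ)) + (c + cᵍ) * ((a + (c + cᵍ)) * P)
  rhs = solve-∀
  rhs′ : P * (2 * N * c + N * a) + 2 * N * cᵍ * P ≡ P * (N * N) + N * ((a + N) * P)
  rhs′ = subst (λ M → P * (2 * M * c + M * a) + 2 * M * cᵍ * P ≡ P * (M * M) + M * ((a + M) * P))
               c+cᵍ≡N (rhs P a c cᵍ)

count-∨-mismatch : ∀ n β (Q : Vec Bool n → Bool) →
                   count (suc n) (λ z → Q (init z) ∨ not (last z == β)) ≡ count n Q + 2 ^ n
count-∨-mismatch n β Q = trans (count-init-last n (λ y c → Q y ∨ not (c == β))) (by-β β)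
  where
  count-Q∨false : count n (λ y → Q y ∨ false) ≡ count n Q
  count-Q∨false = count-cong n (λ y → ∨-identityʳ (Q y))
  count-Q∨true : count n (λ y → Q y ∨ true) ≡ 2 ^ n
  count-Q∨true = trans (count-cong n (λ y → ∨-zeroʳ (Q y))) (count-true n)
  by-β : ∀ β → count n (λ y → Q y ∨ not (false == β)) + count n (λ y → Q y ∨ not (true == β)) ≡ count n Q + 2 ^ n
  by-β false = cong₂ _+_ count-Q∨false count-Q∨true
  by-β true  = trans (cong₂ _+_ count-Q∨true count-Q∨false) (+-comm (2 ^ n) _)

no-advantage : (g : (n : ℕ) → Vec Bool n → Vec Bool (suc n)) → SuperBit g →
               (A : (k : ℕ) → Vec Bool k → Bool) (β : Bool) → InNPpoly (λ k x → not (A k x == β)) →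
               (p : Poly) → ¬ InfinitelyOften (Advantage {λ n → n} (firstBits g) (lastBit g) A β p)
no-advantage g (_ , indistinguishable) A β B∈NP p advantage-io
  with indistinguishable (distinguisher (λ k x → not (A k x == β)) β) (InNPpoly-distinguisher β B∈NP) p
... | n₀ , bound with advantage-io n₀
... | n , n₀≤n , adv = <⇒≱ bound′ (advantage⇒gap P N a c cᵍ {{m^n≢0 2 n}} c+cᵍ≡N adv′)
  where
  B = λ k x → not (A k x == β)
  D = distinguisher B β (suc n)
  P = ⟦ p ⟧ n
  N = 2 ^ n
  a = count n (λ y → B (n + n) (y ++ ones n))
  c = count n (λ x → (A (n + n) (firstBits g n x ++ ones n) == β) ∧ (lastBit g n x == β))
  cᵍ = count n (λ x → D (g n x))

  c+cᵍ≡N : c + cᵍ ≡ N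
  c+cᵍ≡N = begin
    c + cᵍ
      ≡⟨ cong (_+ cᵍ) (count-cong n λ x → ∧-deMorgan (A (n + n) (firstBits g n x ++ ones n) == β) (lastBit g n x == β)) ⟩
    count n (λ x → not (D (g n x))) + cᵍ
      ≡⟨ +-comm _ cᵍ ⟩
    cᵍ + count n (λ x → not (D (g n x)))
      ≡⟨ count-complement n (λ x → D (g n x)) ⟩
    N ∎
    where
    open ≡-Reasoning
    ∧-deMorgan : ∀ u v → u ∧ v ≡ not (not u ∨ not v)
    ∧-deMorgan true  true  = refl
    ∧-deMorgan true  false = refl
    ∧-deMorgan false v     = refl

  adv′ : P * (N * N) + 2 * (N * N) ≤ P * (2 * N * c + N * a)
  adv′ = subst (λ M → P * M + 2 * M ≤ P * (2 * N * c + N * a)) (^-distribˡ-+-* 2 n n) adv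

  bound′ : (a + N) * P < 2 * N + 2 * cᵍ * P
  bound′ = subst (λ d → d * P < 2 * N + 2 * cᵍ * P)
                 (count-∨-mismatch n β (λ y → B (n + n) (y ++ ones n))) (bound n n₀≤n)

InPpoly-reindex : {m m′ : ℕ → ℕ} {F : (n : ℕ) → Vec Bool n → Vec Bool (m n)} →
                  (σ : ∀ {A : Set} n → Vec A (m n) → Vec A (m′ n)) →
                  (∀ {A B : Set} n (f : A → B) v → σ n (map f v) ≡ map f (σ n v)) →
                  InPpoly F → InPpoly {m′} (λ n x → σ n (F n x))
InPpoly-reindex σ σ-natural (p , circuits) = p , λ n →
  let s , C , out , s≤p , correct = circuits n in
  s , C , σ n out , s≤p , λ x → trans (sym (σ-natural n (lookup (eval C x)) out)) (cong (σ n) (correct x))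

map-init : ∀ {A B : Set} (f : A → B) (v : Vec A (suc n)) → init (map f v) ≡ map f (init v)
map-init f (x ∷ [])     = refl
map-init f (x ∷ y ∷ ys) = cong (f x ∷_) (map-init f (y ∷ ys))

map-last : ∀ {A B : Set} (f : A → B) (v : Vec A (suc n)) → last (map f v) ≡ f (last v)
map-last f (x ∷ [])     = refl
map-last f (x ∷ y ∷ ys) = map-last f (y ∷ ys)

not-==-false : ∀ b → not (b == false) ≡ b
not-==-false true  = refl
not-==-false false = refl

not-==-true : ∀ b → not (b == true) ≡ not b
not-==-true true  = refl
not-==-true false = refl

proposition6p11 : (g : (n : ℕ) → Vec Bool n → Vec Bool (suc n)) → SuperBit g →
    InPpoly {λ n → n} (firstBits g) × SuperCore {λ n → n} (firstBits g) (lastBit g)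
proposition6p11 g g-superBit@(g∈P , _) =
  InPpoly-reindex (λ _ → init) (λ _ → map-init) g∈P ,
  InPpoly-reindex (λ _ v → last v ∷ []) (λ _ f v → cong (_∷ []) (map-last f v)) g∈P ,
  (λ (A₁ , A₁∈NP , p , io) →
     no-advantage g g-superBit A₁ false (InNPpoly-cong (λ k x → sym (not-==-false (A₁ k x))) A₁∈NP) p io) ,
  (λ (A₂ , A₂∈coNP , p , io) →
     no-advantage g g-superBit A₂ true (InNPpoly-cong (λ k x → sym (not-==-true (A₂ k x))) A₂∈coNP) p io)
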